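{- Let $a_0,d_0$ be coprime positive integers and let $\langle A(a_0,d_0), A(a_1,d_1), \ldots, A(a_n,d_n)\rangle$ be the sequence of arithmetic progressions $\mathfrak{S}(a_0,d_0)$. Let $\mathcal{G} = \langle A(a_\alpha,d_\alpha), \ldots, A(a_\beta,d_\beta)\rangle$, with $0 \le \alpha < \beta \le n$, be a grouping of $\mathfrak{S}(a_0,d_0)$ with second common difference $\triangle$, and put $z_\alpha = \frac{a_\alpha \triangle + 1}{d_\alpha}$. Then for every $i$ with $\alpha \le i \le \beta$, $$a_i = a_\alpha + \triangle(\beta-i)(i-\alpha) + (i-\alpha)(d_\beta - z_\alpha).$$
   Context: $A(x,y)$ denotes the arithmetic progression with leading term $x$ and common difference $y$. For coprime positive integers $a_0,d_0$, the sequence $\mathfrak{S}(a_0,d_0)$ is the finite sequence of distinct progressions $A(a_0,d_0), A(a_1,d_1), \ldots$ in which each consecutive pair satisfies $(a_k+jd_k)(a_{k+1}+jd_{k+1}) \equiv 1 \pmod{a_k+(j+1)d_k}$ for all $j\ge 0$, and $d_k \ge d_{k+1} \ge 1$. Explicitly: if $d_k = 1$ the sequence stops at $A(a_k,d_k)$; otherwise $d_{k+1}$ is the unique integer with $1 \le d_{k+1} < d_k$ and $a_k d_{k+1} \equiv 1 \pmod{d_k}$, and $a_{k+1} = d_{k+1} + \frac{a_k d_{k+1} - 1}{d_k}$. A grouping of $\mathfrak{S}(a_0,d_0)$ is a run $A(a_\alpha,d_\alpha),\ldots,A(a_\beta,d_\beta)$ of at least two consecutive progressions of the sequence such that $d_r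 - d_{r+1}$ is the same number $\triangle$ for all $\alpha \le r \le \beta-1$, and which is maximal with this property (cannot be extended by a neighbouring progression of the sequence while keeping the differences constant). $\triangle$ is called the second common difference of the grouping. -}

module Defs where

open import Data.Nat using (ℕ; zero; suc; _+_; _*_; _∸_; _≤_; _<_; _/_)
open import Data.Nat.Coprimality using (Coprime)
open import Data.Product using (Σ; _×_)
open import Relation.Binary.PropositionalEquality using (_≡_; _≢_)

-- One step of the sequence 𝔖: from A(a,d) to A(a',d').
-- d' is the integer with 1 ≤ d' < d and a·d' ≡ 1 (mod d), written as
-- a·d' = 1 + q·d; then a' = d' + (a·d' - 1)/d = d' + q.
Step : ℕ → ℕ → ℕ → ℕ → Set
Step a d a' d' =
  (1 ≤ d') × (d' < d) × Σ ℕ (λ q → (a * d' ≡ 1 + q * d) × (a' ≡ d' + q))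

record IsSeq (a₀ d₀ n : ℕ) (a d : ℕ → ℕ) : Set where
  field
    start-a : a 0 ≡ a₀
    start-d : d 0 ≡ d₀
    step    : ∀ k → k < n → Step (a k) (d k) (a (suc k)) (d (suc k))
    stop    : d n ≡ 1

record IsGrouping (n : ℕ) (d : ℕ → ℕ) (α β Δ : ℕ) : Set where
  field
    α<β     : α < β
    β≤n     : β ≤ n
    const   : ∀ r → α ≤ r → r < β → d r ≡ d (suc r) + Δ
    max-left  : ∀ k → suc k ≡ α → d k ≢ d α + Δ
    max-right : β < n → d β ≢ d (suc β) + Δ

-- natural-number division, with an arbitrary convention for divisor 0
-- (never used: it is applied only to d α ≥ 2)
divℕ : ℕ → ℕ → ℕ
divℕ x zero    = 0
divℕ x (suc k) = x / suc k

-- z_α = (a_α Δ + 1) / d_α  (an exact division in the situation of the lemma)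
zα : ℕ → ℕ → ℕ → ℕ
zα aα dα Δ = divℕ (aα * Δ + 1) dα

{-# OPTIONS --safe #-}
module Submission where

open import Defs
open import Data.Nat using (ℕ; _≤_; _<_; _∸_)
open import Data.Nat.Coprimality using (Coprime)
open import Data.Integer using (ℤ; +_; _+_; _*_; _-_)
open import Relation.Binary.PropositionalEquality using (_≡_)

import Data.Nat as ℕ
import Data.Nat.Properties as ℕ
open import Data.Nat.Divisibility using (_∣_; divides)
open import Data.Nat.DivMod using (m/n*n≡m)
open import Data.Integer using (1ℤ; ∣_∣)
open import Data.Integer.Properties using (pos-*; abs-*; *-cancelʳ-≡; +-identityʳ)
open import Data.Integer.Tactic.RingSolver using (solve-∀)
open import Data.Product using (Σ-syntax; _×_; _,_)
open import Relation.Binary.PropositionalEquality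
  using (refl; sym; trans; cong; cong₂; subst; module ≡-Reasoning)
open ≡-Reasoning

-- Write z = (a Δ + 1) / d for a progression A(a,d) of the grouping.  A step
-- A(a,d) → A(a′,d′) with d = d′ + Δ has a d′ = 1 + q d, i.e. (a − q) d = a Δ + 1,
-- so q = a − z and a′ = d′ + q = a + d′ − z; moreover the next z is z + Δ.
-- Thus along the grouping d_m and z_m are linear in m, and summing the
-- increments d_{m+1} − z_m makes a_m quadratic in m, which is the closed form.

divℕ*n≡m : ∀ {m n} → n ∣ m → divℕ m n ℕ.* n ≡ m
divℕ*n≡m {n = ℕ.zero}  (divides q refl) = sym (ℕ.*-zeroʳ q)
divℕ*n≡m {n = ℕ.suc _} n∣m             = m/n*n≡m n∣m

Step-quotient : ∀ {a d a′ d′ Δ} → Step a d a′ d′ → d ≡ d′ ℕ.+ Δ →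
                Σ[ q ∈ ℕ ] ((+ a - + q) * + d ≡ + a * + Δ + 1ℤ) × (+ a′ ≡ + d′ + + q)
Step-quotient {a} {_} {a′} {d′} {Δ} (_ , _ , q , ad′≡ , a′≡) refl = q , quotient , cong +_ a′≡
  where
  ad′≡1+qd : + a * + d′ ≡ 1ℤ + + q * (+ d′ + + Δ)
  ad′≡1+qd = begin
    + a * + d′               ≡⟨ pos-* a d′ ⟨
    + (a ℕ.* d′)             ≡⟨ cong +_ ad′≡ ⟩
    1ℤ + + (q ℕ.* (d′ ℕ.+ Δ)) ≡⟨ cong (λ t → 1ℤ + t) (pos-* q (d′ ℕ.+ Δ)) ⟩
    1ℤ + + q * (+ d′ + + Δ)  ∎

  expand : ∀ a q d′ Δ → (a - q) * (d′ + Δ) ≡ a * Δ + a * d′ - q * (d′ + Δ)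
  expand = solve-∀

  cancel : ∀ x y → x + (1ℤ + y) - y ≡ x + 1ℤ
  cancel = solve-∀

  quotient : (+ a - + q) * (+ d′ + + Δ) ≡ + a * + Δ + 1ℤ
  quotient = begin
    (+ a - + q) * (+ d′ + + Δ)                               ≡⟨ expand (+ a) (+ q) (+ d′) (+ Δ) ⟩
    + a * + Δ + + a * + d′ - + q * (+ d′ + + Δ)              ≡⟨ cong (λ t → + a * + Δ + t - + q * (+ d′ + + Δ)) ad′≡1+qd ⟩
    + a * + Δ + (1ℤ + + q * (+ d′ + + Δ)) - + q * (+ d′ + + Δ) ≡⟨ cancel (+ a * + Δ) (+ q * (+ d′ + + Δ)) ⟩
    + a * + Δ + 1ℤ                                           ∎

Step⇒a′≡a+d′-z : ∀ a Δ z {d a′ d′} → Step a d a′ d′ → d ≡ d′ ℕ.+ Δ →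
                 z * + d ≡ + a * + Δ + 1ℤ → + a′ ≡ + a + + d′ - z
Step⇒a′≡a+d′-z a Δ z {d} {a′} {d′} s@(_ , d′<d , _) d≡ zd≡ with Step-quotient s d≡
... | q , quotient , a′≡ = begin
  + a′                     ≡⟨ a′≡ ⟩
  + d′ + + q               ≡⟨ rearrange (+ a) (+ d′) (+ q) ⟩
  + a + + d′ - (+ a - + q) ≡⟨ cong (λ t → + a + + d′ - t) a-q≡z ⟩
  + a + + d′ - z           ∎
  where
  instance
    d≢0 : ℕ.NonZero d
    d≢0 = ℕ.>-nonZero (ℕ.≤-<-trans ℕ.z≤n d′<d)

  a-q≡z : + a - + q ≡ z
  a-q≡z = *-cancelʳ-≡ (+ a - + q) z (+ d) (trans quotient (sym zd≡))

  rearrange : ∀ a d′ q → d′ + q ≡ a + d′ - (a - q)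
  rearrange = solve-∀

[z+Δ]*d′≡a′*Δ+1 : ∀ a d′ Δ z {d a′} → d ≡ d′ + Δ → z * d ≡ a * Δ + 1ℤ →
                  a′ ≡ a + d′ - z → (z + Δ) * d′ ≡ a′ * Δ + 1ℤ
[z+Δ]*d′≡a′*Δ+1 a d′ Δ z refl zd≡ refl = begin
  (z + Δ) * d′                ≡⟨ split z d′ Δ ⟩
  z * (d′ + Δ) + (d′ - z) * Δ ≡⟨ cong (λ t → t + (d′ - z) * Δ) zd≡ ⟩
  a * Δ + 1ℤ + (d′ - z) * Δ   ≡⟨ collect a d′ Δ z ⟩
  (a + d′ - z) * Δ + 1ℤ       ∎
  where
  split : ∀ z d′ Δ → (z + Δ) * d′ ≡ z * (d′ + Δ) + (d′ - z) * Δ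
  split = solve-∀

  collect : ∀ a d′ Δ z → a * Δ + 1ℤ + (d′ - z) * Δ ≡ (a + d′ - z) * Δ + 1ℤ
  collect = solve-∀

Step⇒zα*d≡a*Δ+1 : ∀ a Δ {d a′ d′} → Step a d a′ d′ → d ≡ d′ ℕ.+ Δ →
                  + zα a d Δ * + d ≡ + a * + Δ + 1ℤ
Step⇒zα*d≡a*Δ+1 a Δ {d} s d≡ with Step-quotient s d≡
... | q , quotient , _ = begin
  + zα a d Δ * + d   ≡⟨ pos-* (zα a d Δ) d ⟨
  + (zα a d Δ ℕ.* d) ≡⟨ cong +_ (divℕ*n≡m d∣aΔ+1) ⟩
  + (a ℕ.* Δ ℕ.+ 1)  ≡⟨ cong (λ t → t + 1ℤ) (pos-* a Δ) ⟩
  + a * + Δ + 1ℤ     ∎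
  where
  d∣aΔ+1 : d ∣ a ℕ.* Δ ℕ.+ 1
  d∣aΔ+1 = divides ∣ + a - + q ∣ (begin
    a ℕ.* Δ ℕ.+ 1         ≡⟨ cong ∣_∣ (trans (cong (λ t → t + 1ℤ) (pos-* a Δ)) (sym quotient)) ⟩
    ∣ (+ a - + q) * + d ∣ ≡⟨ abs-* (+ a - + q) (+ d) ⟩
    ∣ + a - + q ∣ ℕ.* d   ∎)

module RunWithSecondDifference
  (a d : ℕ → ℕ) (Δ ℓ : ℕ)
  (step  : ∀ m → m < ℓ → Step (a m) (d m) (a (ℕ.suc m)) (d (ℕ.suc m)))
  (const : ∀ m → m < ℓ → d m ≡ d (ℕ.suc m) ℕ.+ Δ)
  where

  A D Z : ℤ
  A = + a 0
  D = + d 0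
  Z = + zα (a 0) (d 0) Δ

  z : ℕ → ℤ
  z m = Z + + m * + Δ

  d[m]≡D-m*Δ : ∀ m → m ≤ ℓ → + d m ≡ D - + m * + Δ
  d[m]≡D-m*Δ ℕ.zero    _ = base D (+ Δ)
    where
    base : ∀ D Δ → D ≡ D - + 0 * Δ
    base = solve-∀
  d[m]≡D-m*Δ (ℕ.suc m) h = begin
    + d (ℕ.suc m)             ≡⟨ add-sub (+ d (ℕ.suc m)) (+ Δ) ⟩
    + d (ℕ.suc m) + + Δ - + Δ ≡⟨ cong (λ t → + t - + Δ) (const m h) ⟨
    + d m - + Δ               ≡⟨ cong (λ t → t - + Δ) (d[m]≡D-m*Δ m (ℕ.<⇒≤ h)) ⟩
    D - + m * + Δ - + Δ       ≡⟨ collect D (+ m) (+ Δ) ⟩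
    D - (1ℤ + + m) * + Δ      ∎
    where
    add-sub : ∀ x Δ → x ≡ x + Δ - Δ
    add-sub = solve-∀

    collect : ∀ D m Δ → D - m * Δ - Δ ≡ D - (1ℤ + m) * Δ
    collect = solve-∀

  z[m]*d[m]≡a[m]*Δ+1      : ∀ m → m < ℓ → z m * + d m ≡ + a m * + Δ + 1ℤ
  a[1+m]≡a[m]+d[1+m]-z[m] : ∀ m → m < ℓ → + a (ℕ.suc m) ≡ + a m + + d (ℕ.suc m) - z m

  z[m]*d[m]≡a[m]*Δ+1 ℕ.zero    h =
    trans (cong (λ t → t * D) (+-identityʳ Z)) (Step⇒zα*d≡a*Δ+1 (a 0) Δ (step 0 h) (const 0 h))
  z[m]*d[m]≡a[m]*Δ+1 (ℕ.suc m) h =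
    trans (cong (λ t → t * + d (ℕ.suc m)) (z-suc Z (+ m) (+ Δ)))
          ([z+Δ]*d′≡a′*Δ+1 (+ a m) (+ d (ℕ.suc m)) (+ Δ) (z m)
            (cong +_ (const m m<ℓ)) (z[m]*d[m]≡a[m]*Δ+1 m m<ℓ) (a[1+m]≡a[m]+d[1+m]-z[m] m m<ℓ))
    where
    m<ℓ : m < ℓ
    m<ℓ = ℕ.<-trans (ℕ.n<1+n m) h

    z-suc : ∀ Z m Δ → Z + (1ℤ + m) * Δ ≡ Z + m * Δ + Δ
    z-suc = solve-∀

  a[1+m]≡a[m]+d[1+m]-z[m] m h =
    Step⇒a′≡a+d′-z (a m) Δ (z m) (step m h) (const m h) (z[m]*d[m]≡a[m]*Δ+1 m h)

  a[m]≡A+m*[D-Z]-m*m*Δ : ∀ m → m ≤ ℓ → + a m ≡ A + + m * (D - Z) - + m * + m * + Δ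
  a[m]≡A+m*[D-Z]-m*m*Δ ℕ.zero    _ = base A D Z (+ Δ)
    where
    base : ∀ A D Z Δ → A ≡ A + + 0 * (D - Z) - + 0 * + 0 * Δ
    base = solve-∀
  a[m]≡A+m*[D-Z]-m*m*Δ (ℕ.suc m) h = begin
    + a (ℕ.suc m)                                                       ≡⟨ a[1+m]≡a[m]+d[1+m]-z[m] m h ⟩
    + a m + + d (ℕ.suc m) - z m                                         ≡⟨ cong₂ (λ x y → x + y - z m)
                                                                             (a[m]≡A+m*[D-Z]-m*m*Δ m (ℕ.<⇒≤ h))
                                                                             (d[m]≡D-m*Δ (ℕ.suc m) h) ⟩
    A + M * (D - Z) - M * M * + Δ + (D - (1ℤ + M) * + Δ) - (Z + M * + Δ) ≡⟨ collect A D Z (+ Δ) M ⟩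
    A + (1ℤ + M) * (D - Z) - (1ℤ + M) * (1ℤ + M) * + Δ                  ∎
    where
    M : ℤ
    M = + m

    collect : ∀ A D Z Δ M → A + M * (D - Z) - M * M * Δ + (D - (1ℤ + M) * Δ) - (Z + M * Δ)
                          ≡ A + (1ℤ + M) * (D - Z) - (1ℤ + M) * (1ℤ + M) * Δ
    collect = solve-∀

  a[m]≡A+Δ*p*m+m*[d[m+p]-Z] : ∀ m p → m ℕ.+ p ≤ ℓ →
                              + a m ≡ A + + Δ * + p * + m + + m * (+ d (m ℕ.+ p) - Z)
  a[m]≡A+Δ*p*m+m*[d[m+p]-Z] m p h = begin
    + a m                                             ≡⟨ a[m]≡A+m*[D-Z]-m*m*Δ m (ℕ.m+n≤o⇒m≤o m h) ⟩
    A + M * (D - Z) - M * M * + Δ                     ≡⟨ regroup A D Z (+ Δ) M (+ p) ⟩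
    A + + Δ * + p * M + M * (D - (M + + p) * + Δ - Z) ≡⟨ cong (λ t → A + + Δ * + p * M + M * (t - Z))
                                                            (d[m]≡D-m*Δ (m ℕ.+ p) h) ⟨
    A + + Δ * + p * M + M * (+ d (m ℕ.+ p) - Z)       ∎
    where
    M : ℤ
    M = + m

    regroup : ∀ A D Z Δ M P → A + M * (D - Z) - M * M * Δ ≡ A + Δ * P * M + M * (D - (M + P) * Δ - Z)
    regroup = solve-∀

lemma3 : (a₀ d₀ : ℕ) → 0 < a₀ → 0 < d₀ → Coprime a₀ d₀ →
         (n : ℕ) (a d : ℕ → ℕ) → IsSeq a₀ d₀ n a d →
         (α β Δ : ℕ) → IsGrouping n d α β Δ →
         (i : ℕ) → α ≤ i → i ≤ β →
         + (a i) ≡ + (a α) + + Δ * + (β ∸ i) * + (i ∸ α)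
                   + + (i ∸ α) * (+ (d β) - + (zα (a α) (d α) Δ))
lemma3 _ _ _ _ _ _ a d seq α β Δ grouping i α≤i i≤β = begin
  + a i                                                     ≡⟨ cong (λ k → + a k) (ℕ.m∸n+n≡m α≤i) ⟨
  + a (m ℕ.+ α)                                             ≡⟨ a[m]≡A+Δ*p*m+m*[d[m+p]-Z] m p (ℕ.≤-reflexive m+p≡ℓ) ⟩
  + a α + + Δ * + p * + m + + m * (+ d (m ℕ.+ p ℕ.+ α) - Z) ≡⟨ cong (λ k → + a α + + Δ * + p * + m + + m * (+ d k - Z))
                                                                  m+p+α≡β ⟩
  + a α + + Δ * + p * + m + + m * (+ d β - Z)               ∎
  where
  open IsSeq seq using (step)
  open IsGrouping grouping using (α<β; β≤n; const)

  m p ℓ : ℕ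
  m = i ∸ α
  p = β ∸ i
  ℓ = β ∸ α

  k+α<β : ∀ k → k < ℓ → k ℕ.+ α < β
  k+α<β k k<ℓ = subst (k ℕ.+ α <_) (ℕ.m∸n+n≡m (ℕ.<⇒≤ α<β)) (ℕ.+-monoˡ-< α k<ℓ)

  -- Shifting by k ↦ k + α rather than α + k makes suc k + α reduce to suc (k + α).
  open RunWithSecondDifference (λ k → a (k ℕ.+ α)) (λ k → d (k ℕ.+ α)) Δ ℓ
         (λ k k<ℓ → step (k ℕ.+ α) (ℕ.<-≤-trans (k+α<β k k<ℓ) β≤n))
         (λ k k<ℓ → const (k ℕ.+ α) (ℕ.m≤n+m α k) (k+α<β k k<ℓ))

  m+p+α≡β : m ℕ.+ p ℕ.+ α ≡ β
  m+p+α≡β = begin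
    m ℕ.+ p ℕ.+ α   ≡⟨ cong (ℕ._+ α) (ℕ.+-comm m p) ⟩
    p ℕ.+ m ℕ.+ α   ≡⟨ ℕ.+-assoc p m α ⟩
    p ℕ.+ (m ℕ.+ α) ≡⟨ cong (p ℕ.+_) (ℕ.m∸n+n≡m α≤i) ⟩
    p ℕ.+ i         ≡⟨ ℕ.m∸n+n≡m i≤β ⟩
    β               ∎

  m+p≡ℓ : m ℕ.+ p ≡ ℓ
  m+p≡ℓ = trans (sym (ℕ.m+n∸n≡m (m ℕ.+ p) α)) (cong (_∸ α) m+p+α≡β)
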